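{- Let $\mathcal{P}=(\mathcal{P}^L,\mathcal{P}^F)$ be a symmetric leader protocol in which every state of $Q^F$ is reachable from $\mathit{init}^F$ and can reach $\mathit{fin}^F$ in the follower graph, and let $\mathcal{N}$ be its associated Petri net (transition set $T$, incidence matrix $\mathcal{A}$). Let $par\in\{0,1\}$. There exists $k\in\mathbb{N}$ with $k\equiv par\pmod 2$ and $C^k_{\mathit{init}}\xrightarrow{*}C^k_{\mathit{fin}}$ in $\mathcal{N}$ if and only if there exist $n\in\mathbb{N}$ and $\mathbf{x}\in\mathbb{N}^T$ with $n\equiv par\pmod2$, $(C^n_{\mathit{init}},\mathbf{x})$ compatible, and $C^n_{\mathit{fin}}=C^n_{\mathit{init}}+\mathcal{A}\mathbf{x}$.
   Context: A rendez-vous protocol $(Q,\Sigma,\mathit{init},\mathit{fin},R)$ has finite $Q$, finite alphabet $\Sigma$, $\mathit{init},\mathit{fin}\in Q$, $R\subseteq Q\times\{!a,?a:a\in\Sigma\}\times Q$; it is symmetric if $(q,!a,q')\in R\iff(q,?a,q')\in R$. A symmetric leader protocol is $\mathcal{P}=(\mathcal{P}^L,\mathcal{P}^F)$ with symmetric $\mathcal{P}^L=(Q^L,\Sigma,\mathit{init}^L,\mathit{fin}^L,R^L)$ and $\mathcal{P}^F=(Q^F,\Sigma,\mathit{init}^F,\mathit{fin}^F,R^F)$, $Q^L\cap Q^F=\emptyset$. The follower graph has vertex set $Q^F$ and an edge $(q,q')$ for each rule $(q,\cdot,q')\in R^F$. A configuration is a multiset $C$ over $Q^L\cup Q^F$ with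 $\sum_{q\in Q^L}C(q)=1$; $\mathrm{lead}(C)$ is the unique $q\in Q^L$ with $C(q)>0$. $C^n_{\mathit{init}}$ has one agent in $\mathit{init}^L$ and $n$ in $\mathit{init}^F$; $C^n_{\mathit{fin}}$ has one in $\mathit{fin}^L$ and $n$ in $\mathit{fin}^F$. The net $\mathcal{N}=(P,T,\mathrm{Pre},\mathrm{Post})$ has $P=Q^L\cup Q^F$ and, for each $a\in\Sigma$ and rules $r=(q,!a,s),r'=(q',?a,s')\in R^L\cup R^F$ not both in $R^L$, a transition $t_{r,r'}$ with $\mathrm{Pre}$-column $\langle q,q'\rangle$ and $\mathrm{Post}$-column $\langle s,s'\rangle$ (multisets); $\mathcal{A}=\mathrm{Post}-\mathrm{Pre}$; firing $M\xrightarrow{t}M'$ if $M\ge\mathrm{Pre}[\cdot,t]$ and $M'=M+\mathcal{A}[\cdot,t]$; $\xrightarrow{*}$ is reachability. $t_{r,r'}$ is a leader transition if exactly one of $r,r'$ lies in $R^L$; then $t.\mathit{from}$ (resp. $t.\mathit{to}$) is the unique place of $Q^L$ in the $\mathrm{Pre}$- (resp. $\mathrm{Post}$-) column of $t$. For $\mathbf{x}\in\mathbb{N}^T$, $\mathcal{G}(\mathbf{x})$ has vertices $t.\mathit{from},t.\mathit{to}$ and edges $(t.\mathit{from},t.\mathit{to})$ for leader transitions $t$ with $\mathbf{x}[t]>0$. $(C,\mathbf{x})$ is compatible if $C+\mathcal{A}\mathbf{x}\ge\mathbf{0}$ and every vertex of $\mathcal{G}(\mathbf{x})$ is reachable from $\mathrm{lead}(C)$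 in $\mathcal{G}(\mathbf{x})$. -}

module Defs where

open import Data.Nat using (ℕ; zero; suc; _≤_; _<_)
open import Data.Integer using (ℤ; +_; _-_; _*_) renaming (_+_ to _+ℤ_; _≤_ to _≤ℤ_)
open import Data.Fin using (Fin; _≟_)
open import Data.Bool using (Bool; true; false; _∧_; _∨_; not; _xor_; if_then_else_)
open import Data.Product using (Σ; ∃; _×_; _,_; proj₁; proj₂)
open import Data.Sum using (_⊎_; inj₁; inj₂)
open import Data.Maybe using (Maybe; just; nothing)
open import Data.List using (List; []; _∷_; map; _++_; allFin; cartesianProduct; filterᵇ; length; lookup; foldr)
open import Relation.Nullary.Decidable using (⌊_⌋)
open import Relation.Binary.PropositionalEquality using (_≡_)
open import Relation.Binary.Construct.Closure.ReflexiveTransitive using (Star)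

data Act (m : ℕ) : Set where
  snd rcv : Fin m → Act m

record Protocol (m : ℕ) : Set where
  field
    n    : ℕ
    init : Fin n
    fin  : Fin n
    R    : Fin n → Act m → Fin n → Bool

Symmetric : ∀ {m} → Protocol m → Set
Symmetric P = ∀ q a q' → Protocol.R P q (snd a) q' ≡ Protocol.R P q (rcv a) q'

FEdge : ∀ {m} (P : Protocol m) → Fin (Protocol.n P) → Fin (Protocol.n P) → Set
FEdge {m} P q q' = Σ (Act m) λ α → Protocol.R P q α q' ≡ true

FReach : ∀ {m} (P : Protocol m) → Fin (Protocol.n P) → Fin (Protocol.n P) → Set
FReach P = Star (FEdge P)

allActs : (m : ℕ) → List (Act m)
allActs m = map snd (allFin m) ++ map rcv (allFin m)

triples : (m k : ℕ) → List (Fin k × Act m × Fin k)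
triples m k = cartesianProduct (allFin k) (cartesianProduct (allActs m) (allFin k))

[_==_] : ∀ {k} → Fin k → Fin k → Bool
[ i == j ] = ⌊ i ≟ j ⌋

module Net {m : ℕ} (L F : Protocol m) where
  open Protocol

  Place : Set
  Place = Fin (n L) ⊎ Fin (n F)

  GRule : Set
  GRule = (Fin (n L) × Act m × Fin (n L)) ⊎ (Fin (n F) × Act m × Fin (n F))

  allGRules : List GRule
  allGRules = map inj₁ (triples m (n L)) ++ map inj₂ (triples m (n F))

  inR : GRule → Bool
  inR (inj₁ (q , α , q')) = R L q α q'
  inR (inj₂ (q , α , q')) = R F q α q'

  isLeaderRule : GRule → Bool
  isLeaderRule (inj₁ _) = true
  isLeaderRule (inj₂ _) = false

  src tgt : GRule → Place
  src (inj₁ (q , _ , _)) = inj₁ q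
  src (inj₂ (q , _ , _)) = inj₂ q
  tgt (inj₁ (_ , _ , q')) = inj₁ q'
  tgt (inj₂ (_ , _ , q')) = inj₂ q'

  act : GRule → Act m
  act (inj₁ (_ , α , _)) = α
  act (inj₂ (_ , α , _)) = α

  sendRecv : Act m → Act m → Bool
  sendRecv (snd a) (rcv b) = [ a == b ]
  sendRecv _ _ = false

  validPair : GRule × GRule → Bool
  validPair (r , r') = inR r ∧ inR r' ∧ sendRecv (act r) (act r')
                       ∧ not (isLeaderRule r ∧ isLeaderRule r')

  Ts : List (GRule × GRule)
  Ts = filterᵇ validPair (cartesianProduct allGRules allGRules)

  T : Set
  T = Fin (length Ts)

  rules : T → GRule × GRule
  rules t = lookup Ts t

  [_≟P_] : Place → Place → Bool
  [ inj₁ p ≟P inj₁ q ] = [ p == q ]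
  [ inj₂ p ≟P inj₂ q ] = [ p == q ]
  [ _ ≟P _ ] = false

  ind : Bool → ℕ
  ind true = 1
  ind false = 0

  Pre Post : Place → T → ℕ
  Pre p t = ind [ p ≟P src (proj₁ (rules t)) ] Data.Nat.+ ind [ p ≟P src (proj₂ (rules t)) ]
  Post p t = ind [ p ≟P tgt (proj₁ (rules t)) ] Data.Nat.+ ind [ p ≟P tgt (proj₂ (rules t)) ]

  𝒜 : Place → T → ℤ
  𝒜 p t = + Post p t - + Pre p t

  Marking : Set
  Marking = Place → ℕ

  𝒜· : (T → ℕ) → Place → ℤ
  𝒜· x p = foldr (λ t acc → 𝒜 p t * + x t +ℤ acc) (+ 0) (allFin (length Ts))

  Fires : Marking → T → Marking → Set
  Fires M t M' = (∀ p → Pre p t ≤ M p) × (∀ p → + M' p ≡ + M p +ℤ 𝒜 p t)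

  data Reach : Marking → Marking → Set where
    done : ∀ {M M'} → (∀ p → M p ≡ M' p) → Reach M M'
    step : ∀ {M M' M'' t} → Fires M t M' → Reach M' M'' → Reach M M''

  -- configurations: multisets with exactly one agent in Q^L (the leader, in state lead)
  record Config : Set where
    field
      lead : Fin (n L)
      fol  : Fin (n F) → ℕ

  toM : Config → Marking
  toM C (inj₁ q) = ind [ q == Config.lead C ]
  toM C (inj₂ q) = Config.fol C q

  Cinit Cfin : ℕ → Config
  Cinit k = record { lead = init L ; fol = λ q → if [ q == init F ] then k else 0 }
  Cfin  k = record { lead = fin L  ; fol = λ q → if [ q == fin F ] then k else 0 }

  isLeaderT : T → Bool
  isLeaderT t = isLeaderRule (proj₁ (rules t)) xor isLeaderRule (proj₂ (rules t))

  leaderSrc leaderTgt : GRule → Maybe (Fin (n L))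
  leaderSrc (inj₁ (q , _ , _)) = just q
  leaderSrc (inj₂ _) = nothing
  leaderTgt (inj₁ (_ , _ , q')) = just q'
  leaderTgt (inj₂ _) = nothing

  orElse : Maybe (Fin (n L)) → Maybe (Fin (n L)) → Maybe (Fin (n L))
  orElse (just q) _ = just q
  orElse nothing o = o

  from to : T → Maybe (Fin (n L))
  from t = orElse (leaderSrc (proj₁ (rules t))) (leaderSrc (proj₂ (rules t)))
  to   t = orElse (leaderTgt (proj₁ (rules t))) (leaderTgt (proj₂ (rules t)))

  GEdge : (T → ℕ) → Fin (n L) → Fin (n L) → Set
  GEdge x u v = Σ T λ t → isLeaderT t ≡ true × 0 < x t × from t ≡ just u × to t ≡ just v

  GVertex : (T → ℕ) → Fin (n L) → Set
  GVertex x v = Σ T λ t → isLeaderT t ≡ true × 0 < x t × (from t ≡ just v ⊎ to t ≡ just v)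

  GReach : (T → ℕ) → Fin (n L) → Fin (n L) → Set
  GReach x = Star (GEdge x)

  Compatible : Config → (T → ℕ) → Set
  Compatible C x = (∀ p → + 0 ≤ℤ + toM C p +ℤ 𝒜· x p)
                 × (∀ v → GVertex x v → GReach x (Config.lead C) v)

module Submission where

-- A run from C^k_init to C^k_fin has as Parikh vector x a solution of the marking equation, and
-- the leader moves along every edge of 𝒢(x) in turn, so 𝒢(x) is reachable from init^L.
--
-- Conversely, let x be a compatible solution.  Its leader transitions form a multigraph on Q^L
-- that is balanced (the leader places of the marking equation) and connected from init^L, so
-- they can be ordered as an Eulerian walk from init^L to fin^L: split off a walk greedily, then
-- splice in the remaining cycles, each of which meets the walk by connectivity.  Appending the
-- follower transitions of x in any order, the sequence can be fired as soon as every follower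
-- state holds enough followers.  Symmetry lets two followers in the same state fire a follower
-- rule together, so before the run pairs of followers can be moved from init^F to every state
-- along the follower graph, and afterwards gathered at fin^F.  This pumps an even number of
-- followers, so the parity of the population is preserved.

open import Defs
open import Data.Bool using (Bool; true; false; if_then_else_; _∧_)
import Data.Bool.Properties as BoolP
open import Data.Fin as F using (Fin; zero; suc)
import Data.Fin.Properties as FinP
open import Data.Integer as ℤ using (ℤ; +_; _-_; +≤+) renaming (_+_ to _+ℤ_)
import Data.Integer.Properties as ℤP
import Data.Integer.Tactic.RingSolver as ℤSolver
open import Data.List as List using (List; []; _∷_; _++_)
open import Data.List.Membership.Propositional using (_∈_)
open import Data.List.Membership.Propositional.Properties
  using (∈-map⁺; ∈-++⁺ˡ; ∈-++⁺ʳ; ∈-cartesianProduct⁺; ∈-allFin; ∈-filter⁺; ∈-lookup)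
import Data.List.Properties as ListP
open import Data.List.Relation.Unary.All as All using (All; []; _∷_)
open import Data.List.Relation.Unary.All.Properties using (all-filter)
import Data.List.Relation.Unary.Any as Any
open import Data.List.Relation.Unary.Any.Properties using (lookup-index)
open import Data.Maybe using (Maybe; just; fromMaybe)
import Data.Maybe.Properties as MaybeP
open import Data.Nat as ℕ using (ℕ; zero; suc; _+_; _*_; _∸_; _≤_; _<_; _%_; z≤n; s≤s)
open import Data.Nat.DivMod using ([m+kn]%n≡m%n)
open import Data.Nat.ListAction using () renaming (sum to sumList)
import Data.Nat.Properties as ℕP
open import Data.Nat.Tactic.RingSolver using (solve-∀)
open import Data.Product using (Σ; ∃; _×_; _,_; proj₁; proj₂)
open import Data.Sum using (_⊎_; inj₁; inj₂)
open import Function using (_∘_; const; id)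
open import Function.Bundles using (_⇔_; mk⇔; Equivalence)
open import Relation.Binary.Construct.Closure.ReflexiveTransitive using (Star; ε; _◅_; gmap)
open import Relation.Binary.PropositionalEquality
open import Relation.Nullary using (yes; no; Dec)
open import Relation.Nullary.Decidable using (T?)
open import Relation.Nullary.Negation using (contradiction; ¬∃⟶∀¬)

open import Algebra.Properties.CommutativeMonoid.Sum ℕP.+-0-commutativeMonoid
  using (sum; sum-cong-≗; ∑-distrib-+; sum-replicate-zero)
open import Algebra.Properties.CommutativeSemigroup ℕP.+-commutativeSemigroup
  using (x∙yz≈xz∙y; xy∙z≈xz∙y; x∙yz≈zy∙x)
-- Kronecker delta and finite sums

δ : ∀ {k} → Fin k → Fin k → ℕ
δ i j = if [ i == j ] then 1 else 0

δ-≡ : ∀ {k} {i j : Fin k} → i ≡ j → δ i j ≡ 1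
δ-≡ {i = i} {j} i≡j with i F.≟ j
... | yes _ = refl
... | no i≢j = contradiction i≡j i≢j

δ-≢ : ∀ {k} {i j : Fin k} → i ≢ j → δ i j ≡ 0
δ-≢ {i = i} {j} i≢j with i F.≟ j
... | yes i≡j = contradiction i≡j i≢j
... | no _ = refl

δ-refl : ∀ {k} (i : Fin k) → δ i i ≡ 1
δ-refl i = δ-≡ refl

δ-sym : ∀ {k} (i j : Fin k) → δ i j ≡ δ j i
δ-sym i j with i F.≟ j
... | yes i≡j = sym (δ-≡ (sym i≡j))
... | no i≢j = sym (δ-≢ (i≢j ∘ sym))

δ-suc : ∀ {k} (i j : Fin k) → δ (suc i) (suc j) ≡ δ i j
δ-suc i j with i F.≟ j
... | yes _ = refl
... | no _ = refl

δ-positive : ∀ {k} {i j : Fin k} → 0 < δ i j → i ≡ j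
δ-positive {i = i} {j} pos with i F.≟ j
... | yes i≡j = i≡j
δ-positive () | no _

if-as-δ : ∀ {k} (n : ℕ) (i j : Fin k) → (if [ i == j ] then n else 0) ≡ n * δ i j
if-as-δ n i j with [ i == j ]
... | true = sym (ℕP.*-identityʳ n)
... | false = sym (ℕP.*-zeroʳ n)

sum-zero : ∀ {k} {f : Fin k → ℕ} → (∀ i → f i ≡ 0) → sum f ≡ 0
sum-zero {k} f≡0 = trans (sum-cong-≗ f≡0) (sum-replicate-zero k)

sum-const : ∀ k c → sum {k} (const c) ≡ k * c
sum-const zero c = refl
sum-const (suc k) c = cong (_+_ c) (sum-const k c)

sum-δ : ∀ {k} (j : Fin k) (g : Fin k → ℕ) → sum (λ i → δ i j * g i) ≡ g j
sum-δ zero g = trans (cong₂ _+_ (ℕP.+-identityʳ (g zero)) elsewhere) (ℕP.+-identityʳ (g zero))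
  where
  elsewhere : sum (λ i → δ (suc i) zero * g (suc i)) ≡ 0
  elsewhere = sum-zero {f = λ i → δ (suc i) zero * g (suc i)} (λ _ → refl)
sum-δ (suc j) g = trans (sum-cong-≗ (λ i → cong (_* g (suc i)) (δ-suc i j))) (sum-δ j (g ∘ suc))

sum-δ′ : ∀ {k} (j : Fin k) (g : Fin k → ℕ) → sum (λ i → g i * δ j i) ≡ g j
sum-δ′ j g = trans (sum-cong-≗ (λ i → trans (ℕP.*-comm (g i) (δ j i)) (cong (_* g i) (δ-sym j i)))) (sum-δ j g)

sum-mono-≤ : ∀ {k} {f g : Fin k → ℕ} → (∀ i → f i ≤ g i) → sum f ≤ sum g
sum-mono-≤ {zero} f≤g = z≤n
sum-mono-≤ {suc k} f≤g = ℕP.+-mono-≤ (f≤g zero) (sum-mono-≤ (f≤g ∘ suc))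

≤-sum : ∀ {k} (f : Fin k → ℕ) i → f i ≤ sum f
≤-sum f zero = ℕP.m≤m+n _ _
≤-sum f (suc i) = ℕP.≤-trans (≤-sum (f ∘ suc) i) (ℕP.m≤n+m _ (f zero))

zero-or-positive : ∀ {k} (f : Fin k → ℕ) → (∀ i → f i ≡ 0) ⊎ ∃ λ i → 0 < f i
zero-or-positive f with FinP.any? (λ i → 0 ℕ.<? f i)
... | yes positive = inj₂ positive
... | no none = inj₁ λ i → ℕP.n≤0⇒n≡0 (ℕP.≮⇒≥ (¬∃⟶∀¬ none i))

positive-sum : ∀ {k} (f : Fin k → ℕ) → 0 < sum f → ∃ λ i → 0 < f i
positive-sum f pos with zero-or-positive f
... | inj₂ positive = positive
... | inj₁ f≡0 = contradiction (sum-zero f≡0) (ℕP.m<n⇒n≢0 pos)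

*-positive⁻¹ : ∀ m n → 0 < m * n → 0 < m × 0 < n
*-positive⁻¹ (suc m) (suc n) _ = s≤s z≤n , s≤s z≤n
*-positive⁻¹ (suc m) zero pos = contradiction (ℕP.*-zeroʳ (suc m)) (ℕP.m<n⇒n≢0 pos)

sum-tabulate : ∀ {k} (f : Fin k → ℕ) → sumList (List.tabulate f) ≡ sum f
sum-tabulate {zero} f = refl
sum-tabulate {suc k} f = cong (_+_ (f zero)) (sum-tabulate (f ∘ suc))

sum-allFin : ∀ {k} (f : Fin k → ℕ) → sumList (List.map f (List.allFin k)) ≡ sum f
sum-allFin f = trans (cong sumList (ListP.map-tabulate id f)) (sum-tabulate f)

-- Multiplicities of list elements

count : ∀ {k} → List (Fin k) → Fin k → ℕ
count [] e = 0
count (t ∷ σ) e = δ e t + count σ e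

count-++ : ∀ {k} (σ τ : List (Fin k)) e → count (σ ++ τ) e ≡ count σ e + count τ e
count-++ [] τ e = refl
count-++ (t ∷ σ) τ e = trans (cong (_+_ (δ e t)) (count-++ σ τ e)) (sym (ℕP.+-assoc (δ e t) _ _))

count-head : ∀ {k} (t : Fin k) σ → 0 < count (t ∷ σ) t
count-head t σ = subst (λ c → 0 < c + count σ t) (sym (δ-refl t)) (s≤s z≤n)

count-tail : ∀ {k} (t : Fin k) σ e → count σ e ≤ count (t ∷ σ) e
count-tail t σ e = ℕP.m≤n+m (count σ e) (δ e t)

count⇒All : ∀ {k} {P : Fin k → Set} σ → (∀ e → 0 < count σ e → P e) → All P σ
count⇒All [] _ = []
count⇒All (t ∷ σ) P = P t (count-head t σ) ∷ count⇒All σ λ e pos → P e (ℕP.≤-trans pos (count-tail t σ e))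

sum-count : ∀ {k} (g : Fin k → ℕ) σ → sum (λ i → count σ i * g i) ≡ sumList (List.map g σ)
sum-count {k} g [] = sum-zero {k} (λ _ → refl)
sum-count g (t ∷ σ) = begin
  sum (λ i → (δ i t + count σ i) * g i)
    ≡⟨ sum-cong-≗ (λ i → ℕP.*-distribʳ-+ (g i) (δ i t) (count σ i)) ⟩
  sum (λ i → δ i t * g i + count σ i * g i)
    ≡⟨ ∑-distrib-+ (λ i → δ i t * g i) (λ i → count σ i * g i) ⟩
  sum (λ i → δ i t * g i) + sum (λ i → count σ i * g i)
    ≡⟨ cong₂ _+_ (sum-δ t g) (sum-count g σ) ⟩
  g t + sumList (List.map g σ) ∎
  where open ≡-Reasoning

fromCounts : ∀ {k} → (Fin k → ℕ) → List (Fin k)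
fromCounts {zero} y = []
fromCounts {suc k} y = List.replicate (y zero) zero ++ List.map suc (fromCounts (y ∘ suc))

count-replicate : ∀ {k} c (t e : Fin k) → count (List.replicate c t) e ≡ c * δ e t
count-replicate zero t e = refl
count-replicate (suc c) t e = cong (_+_ (δ e t)) (count-replicate c t e)

count-map-suc : ∀ {k} (σ : List (Fin k)) e → count (List.map suc σ) (suc e) ≡ count σ e
count-map-suc [] e = refl
count-map-suc (t ∷ σ) e = cong₂ _+_ (δ-suc e t) (count-map-suc σ e)

count-map-suc-zero : ∀ {k} (σ : List (Fin k)) → count (List.map suc σ) zero ≡ 0
count-map-suc-zero [] = refl
count-map-suc-zero (t ∷ σ) = count-map-suc-zero σ

count-fromCounts : ∀ {k} (y : Fin k → ℕ) e → count (fromCounts y) e ≡ y e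
count-fromCounts {suc k} y e = trans (count-++ (List.replicate (y zero) zero) _ e) (split e)
  where
  split : ∀ e → count (List.replicate (y zero) zero) e + count (List.map suc (fromCounts (y ∘ suc))) e ≡ y e
  split zero = trans (cong₂ _+_ (trans (count-replicate (y zero) zero zero) (ℕP.*-identityʳ (y zero)))
                                (count-map-suc-zero (fromCounts (y ∘ suc))))
                     (ℕP.+-identityʳ (y zero))
  split (suc e) = cong₂ _+_ (trans (count-replicate (y zero) zero (suc e)) (ℕP.*-zeroʳ (y zero)))
                            (trans (count-map-suc (fromCounts (y ∘ suc)) e) (count-fromCounts (y ∘ suc) e))

lookup-filterᵇ : ∀ {A : Set} (P : A → Bool) (xs : List A) i → P (List.lookup (List.filterᵇ P xs) i) ≡ true
lookup-filterᵇ P xs i = Equivalence.to BoolP.T-≡ (All.lookup (all-filter (T? ∘ P) xs) (∈-lookup i))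

-- Balances of markings

-- N = M − a + b, stated without truncated subtraction.
record Shift {P : Set} (M a b N : P → ℕ) : Set where
  constructor shifting
  field balance : ∀ p → N p + a p ≡ M p + b p

module _ {P : Set} where

  Shift-trans : ∀ {M L N a b a′ b′ : P → ℕ} → Shift M a b L → Shift L a′ b′ N →
                Shift M (λ p → a p + a′ p) (λ p → b p + b′ p) N
  Shift-trans {M} {L} {N} {a} {b} {a′} {b′} (shifting M→L) (shifting L→N) = shifting λ p → begin
    N p + (a p + a′ p)   ≡⟨ x∙yz≈xz∙y (N p) (a p) (a′ p) ⟩
    (N p + a′ p) + a p   ≡⟨ cong (_+ a p) (L→N p) ⟩
    (L p + b′ p) + a p   ≡⟨ xy∙z≈xz∙y (L p) (b′ p) (a p) ⟩
    (L p + a p) + b′ p   ≡⟨ cong (_+ b′ p) (M→L p) ⟩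
    (M p + b p) + b′ p   ≡⟨ ℕP.+-assoc (M p) (b p) (b′ p) ⟩
    M p + (b p + b′ p)   ∎
    where open ≡-Reasoning

  Shift-functional : ∀ {M N N′ a b : P → ℕ} → Shift M a b N → Shift M a b N′ → ∀ p → N p ≡ N′ p
  Shift-functional {a = a} (shifting M→N) (shifting M→N′) p =
    ℕP.+-cancelʳ-≡ (a p) _ _ (trans (M→N p) (sym (M→N′ p)))

  Shift-bound : ∀ {M N a b : P → ℕ} → Shift M a b N → ∀ p c → a p + c ≤ M p → c ≤ N p
  Shift-bound {M} {N} {a} {b} (shifting M→N) p c enough = ℕP.+-cancelʳ-≤ (a p) c (N p) (begin
    c + a p     ≡⟨ ℕP.+-comm c (a p) ⟩
    a p + c     ≤⟨ enough ⟩
    M p         ≤⟨ ℕP.m≤m+n (M p) (b p) ⟩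
    M p + b p   ≡⟨ M→N p ⟨
    N p + a p   ∎)
    where open ℕP.≤-Reasoning

  Shift-sym : ∀ {M N a b : P → ℕ} → Shift M a b N → Shift N b a M
  Shift-sym (shifting M→N) = shifting λ p → sym (M→N p)

  Shift-cong : ∀ {M N a a′ b b′ : P → ℕ} → Shift M a b N → (∀ p → a p ≡ a′ p) → (∀ p → b p ≡ b′ p) →
               Shift M a′ b′ N
  Shift-cong {M} {N} (shifting M→N) a≗a′ b≗b′ = shifting λ p →
    trans (cong (_+_ (N p)) (sym (a≗a′ p))) (trans (M→N p) (cong (_+_ (M p)) (b≗b′ p)))

  Shift-chain : ∀ {M L N a b c : P → ℕ} → Shift M a b L → Shift L b c N → Shift M a c N
  Shift-chain {M} {L} {N} {a} {b} {c} (shifting M→L) (shifting L→N) =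
    shifting λ p → ℕP.+-cancelʳ-≡ (b p) _ _ (begin
      N p + a p + b p   ≡⟨ xy∙z≈xz∙y (N p) (a p) (b p) ⟩
      N p + b p + a p   ≡⟨ cong (_+ a p) (L→N p) ⟩
      L p + c p + a p   ≡⟨ xy∙z≈xz∙y (L p) (c p) (a p) ⟩
      L p + a p + c p   ≡⟨ cong (_+ c p) (M→L p) ⟩
      M p + b p + c p   ≡⟨ xy∙z≈xz∙y (M p) (b p) (c p) ⟩
      M p + c p + b p   ∎)
    where open ≡-Reasoning

  Shift-+ : ∀ {M N a b : P → ℕ} (E : P → ℕ) → Shift M a b N → Shift (λ p → M p + E p) a b (λ p → N p + E p)
  Shift-+ {M} {N} {a} {b} E (shifting M→N) = shifting λ p → begin
    N p + E p + a p   ≡⟨ xy∙z≈xz∙y (N p) (E p) (a p) ⟩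
    N p + a p + E p   ≡⟨ cong (_+ E p) (M→N p) ⟩
    M p + b p + E p   ≡⟨ xy∙z≈xz∙y (M p) (b p) (E p) ⟩
    M p + E p + b p   ∎
    where open ≡-Reasoning

shift⇒ℤ : ∀ {n m a b} → n + a ≡ m + b → + n ≡ + m +ℤ (+ b - + a)
shift⇒ℤ {n} {m} {a} {b} eq = begin
  + n                       ≡⟨ cancel (+ n) (+ a) ⟩
  (+ n +ℤ + a) - + a        ≡⟨ cong (_- + a) (trans (sym (ℤP.pos-+ n a)) (trans (cong +_ eq) (ℤP.pos-+ m b))) ⟩
  (+ m +ℤ + b) - + a        ≡⟨ reassociate (+ m) (+ b) (+ a) ⟩
  + m +ℤ (+ b - + a)        ∎
  where
  open ≡-Reasoning
  cancel : ∀ x y → x ≡ (x +ℤ y) - y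
  cancel = ℤSolver.solve-∀
  reassociate : ∀ x y z → (x +ℤ y) - z ≡ x +ℤ (y - z)
  reassociate = ℤSolver.solve-∀

ℤ⇒shift : ∀ {n m a b} → + n ≡ + m +ℤ (+ b - + a) → n + a ≡ m + b
ℤ⇒shift {n} {m} {a} {b} eq = ℤP.+-injective (begin
  + (n + a)                   ≡⟨ ℤP.pos-+ n a ⟩
  + n +ℤ + a                  ≡⟨ cong (_+ℤ + a) eq ⟩
  + m +ℤ (+ b - + a) +ℤ + a   ≡⟨ cancel (+ m) (+ b) (+ a) ⟩
  + m +ℤ + b                  ≡⟨ ℤP.pos-+ m b ⟨
  + (m + b)                   ∎)
  where
  open ≡-Reasoning
  cancel : ∀ x y z → x +ℤ (y - z) +ℤ z ≡ x +ℤ y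
  cancel = ℤSolver.solve-∀

foldr-differences : ∀ {A : Set} (h : A → ℤ) (a b : A → ℕ) → (∀ x → h x ≡ + a x - + b x) → ∀ xs →
  List.foldr (λ x acc → h x +ℤ acc) (+ 0) xs ≡ + sumList (List.map a xs) - + sumList (List.map b xs)
foldr-differences h a b h≡a-b [] = refl
foldr-differences h a b h≡a-b (x ∷ xs) = begin
  h x +ℤ List.foldr (λ x acc → h x +ℤ acc) (+ 0) xs
    ≡⟨ cong₂ _+ℤ_ (h≡a-b x) (foldr-differences h a b h≡a-b xs) ⟩
  (+ a x - + b x) +ℤ (+ A - + B)
    ≡⟨ regroup (+ a x) (+ b x) (+ A) (+ B) ⟩
  (+ a x +ℤ + A) - (+ b x +ℤ + B)
    ≡⟨ cong₂ _-_ (ℤP.pos-+ (a x) A) (ℤP.pos-+ (b x) B) ⟨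
  + (a x + A) - + (b x + B) ∎
  where
  A = sumList (List.map a xs)
  B = sumList (List.map b xs)
  open ≡-Reasoning
  regroup : ∀ p q r s → (p - q) +ℤ (r - s) ≡ (p +ℤ r) - (q +ℤ s)
  regroup = ℤSolver.solve-∀

-- Eulerian walks in multigraphs

module Eulerian {V E : ℕ} (s d : Fin E → Fin V) where

  outdeg indeg : (Fin E → ℕ) → Fin V → ℕ
  outdeg r v = sum (λ e → r e * δ v (s e))
  indeg r v = sum (λ e → r e * δ v (d e))

  -- Euler's balance condition for the edge multiset r to be traversed by a walk from a to b.
  Flow : (Fin E → ℕ) → Fin V → Fin V → Set
  Flow r a b = ∀ v → δ v b + outdeg r v ≡ δ v a + indeg r v

  Circulation : (Fin E → ℕ) → Set
  Circulation r = ∀ v → outdeg r v ≡ indeg r v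

  circulation⇒flow : ∀ {r} a → Circulation r → Flow r a a
  circulation⇒flow a circ v = cong (_+_ (δ v a)) (circ v)

  flow⇒circulation : ∀ {r a} → Flow r a a → Circulation r
  flow⇒circulation {a = a} flow v = ℕP.+-cancelˡ-≡ (δ v a) _ _ (flow v)

  Edge : (Fin E → ℕ) → Fin V → Fin V → Set
  Edge r u v = ∃ λ e → 0 < r e × s e ≡ u × d e ≡ v

  _─_ : (Fin E → ℕ) → Fin E → Fin E → ℕ
  (r ─ e) i = r i ∸ δ i e

  ─-+δ : ∀ {r e} → 0 < r e → ∀ i → (r ─ e) i + δ i e ≡ r i
  ─-+δ {r} {e} pos i with i F.≟ e
  ... | yes refl = ℕP.m∸n+n≡m pos
  ... | no _ = ℕP.+-identityʳ (r i)

  sum-─ : ∀ {r e} → 0 < r e → ∀ X → sum (λ i → (r ─ e) i * X i) + X e ≡ sum (λ i → r i * X i)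
  sum-─ {r} {e} pos X = begin
    sum (λ i → r′ i * X i) + X e
      ≡⟨ cong (_+_ (sum (λ i → r′ i * X i))) (sum-δ e X) ⟨
    sum (λ i → r′ i * X i) + sum (λ i → δ i e * X i)
      ≡⟨ ∑-distrib-+ (λ i → r′ i * X i) (λ i → δ i e * X i) ⟨
    sum (λ i → r′ i * X i + δ i e * X i)
      ≡⟨ sum-cong-≗ (λ i → ℕP.*-distribʳ-+ (X i) (r′ i) (δ i e)) ⟨
    sum (λ i → (r′ i + δ i e) * X i)
      ≡⟨ sum-cong-≗ (λ i → cong (_* X i) (─-+δ pos i)) ⟩
    sum (λ i → r i * X i) ∎
    where
    r′ = r ─ e
    open ≡-Reasoning

  sum-─-< : ∀ {r e} → 0 < r e → sum (r ─ e) < sum r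
  sum-─-< {r} {e} pos = ℕP.≤-reflexive (begin
    suc (sum (r ─ e))                 ≡⟨ ℕP.+-comm 1 (sum (r ─ e)) ⟩
    sum (r ─ e) + 1                   ≡⟨ cong (_+ 1) (sum-cong-≗ (λ i → ℕP.*-identityʳ ((r ─ e) i))) ⟨
    sum (λ i → (r ─ e) i * 1) + 1     ≡⟨ sum-─ pos (const 1) ⟩
    sum (λ i → r i * 1)               ≡⟨ sum-cong-≗ (λ i → ℕP.*-identityʳ (r i)) ⟩
    sum r                             ∎)
    where open ≡-Reasoning

  Flow-─ : ∀ {r e a b} → 0 < r e → s e ≡ a → Flow r a b → Flow (r ─ e) (d e) b
  Flow-─ {r} {e} {b = b} pos refl flow v = ℕP.+-cancelʳ-≡ (δ v (s e)) _ _ (begin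
    δ v b + outdeg r′ v + δ v (s e)         ≡⟨ ℕP.+-assoc (δ v b) _ _ ⟩
    δ v b + (outdeg r′ v + δ v (s e))       ≡⟨ cong (_+_ (δ v b)) (sum-─ pos (λ i → δ v (s i))) ⟩
    δ v b + outdeg r v                      ≡⟨ flow v ⟩
    δ v (s e) + indeg r v                   ≡⟨ cong (_+_ (δ v (s e))) (sum-─ pos (λ i → δ v (d i))) ⟨
    δ v (s e) + (indeg r′ v + δ v (d e))    ≡⟨ x∙yz≈zy∙x (δ v (s e)) (indeg r′ v) (δ v (d e)) ⟩
    δ v (d e) + indeg r′ v + δ v (s e)      ∎)
    where
    r′ = r ─ e
    open ≡-Reasoning

  outgoing-edge : ∀ {r a b} → a ≢ b → Flow r a b → ∃ λ e → 0 < r e × s e ≡ a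
  outgoing-edge {r} {a} {b} a≢b flow with positive-sum _ outdeg-positive
    where
    outdeg-positive : 0 < outdeg r a
    outdeg-positive = subst (0 <_) (sym (begin
      outdeg r a                 ≡⟨ cong (_+ outdeg r a) (δ-≢ a≢b) ⟨
      δ a b + outdeg r a         ≡⟨ flow a ⟩
      δ a a + indeg r a          ≡⟨ cong (_+ indeg r a) (δ-refl a) ⟩
      suc (indeg r a)            ∎)) (s≤s z≤n)
      where open ≡-Reasoning
  ... | e , pos with *-positive⁻¹ (r e) _ pos
  ...   | re>0 , δ>0 = e , re>0 , sym (δ-positive δ>0)

  data Walk : Fin V → List (Fin E) → Fin V → Set where
    [] : ∀ {a} → Walk a [] a
    step : ∀ {a e σ b} → s e ≡ a → Walk (d e) σ b → Walk a (e ∷ σ) b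

  _++ʷ_ : ∀ {a b c σ τ} → Walk a σ b → Walk b τ c → Walk a (σ ++ τ) c
  [] ++ʷ w′ = w′
  step p w ++ʷ w′ = step p (w ++ʷ w′)

  record Visit (a : Fin V) (σ : List (Fin E)) (b u : Fin V) : Set where
    field
      before after : List (Fin E)
      splits : σ ≡ before ++ after
      walk-before : Walk a before u
      walk-after : Walk u after b

  visit-target : ∀ {a σ b e} → Walk a σ b → 0 < count σ e → Visit a σ b (d e)
  visit-target {e = e} (step {e = e′} {σ} p w) pos with e F.≟ e′
  ... | yes refl = record { before = e ∷ [] ; after = σ ; splits = refl
                           ; walk-before = step p [] ; walk-after = w }
  ... | no _ = record { before = e′ ∷ before ; after = after ; splits = cong (e′ ∷_) splits
                       ; walk-before = step p walk-before ; walk-after = walk-after }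
    where open Visit (visit-target w pos)

  record Decomposition (r : Fin E → ℕ) (a b : Fin V) : Set where
    field
      edges : List (Fin E)
      walk : Walk a edges b
      cycles : Fin E → ℕ
      circulation : Circulation cycles
      partition : ∀ e → count edges e + cycles e ≡ r e

  stay : ∀ {r a} → Flow r a a → Decomposition r a a
  stay {r} flow = record { edges = [] ; walk = [] ; cycles = r ; circulation = flow⇒circulation {r} flow
                         ; partition = λ _ → refl }

  prepend : ∀ {r e a b} → 0 < r e → s e ≡ a → Decomposition (r ─ e) (d e) b → Decomposition r a b
  prepend {r} {e} pos p D = record
    { edges = e ∷ edges ; walk = step p walk ; cycles = cycles ; circulation = circulation
    ; partition = λ i → begin
        δ i e + count edges i + cycles i     ≡⟨ ℕP.+-assoc (δ i e) _ _ ⟩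
        δ i e + (count edges i + cycles i)   ≡⟨ cong (_+_ (δ i e)) (partition i) ⟩
        δ i e + (r ─ e) i                    ≡⟨ ℕP.+-comm (δ i e) _ ⟩
        (r ─ e) i + δ i e                    ≡⟨ ─-+δ pos i ⟩
        r i                                  ∎ }
    where
    open Decomposition D
    open ≡-Reasoning

  -- While a ≢ b the balance at a provides an unused edge leaving a; n is fuel bounding sum r.
  decompose : ∀ n r → sum r ≤ n → ∀ {a b} → Flow r a b → Decomposition r a b
  decompose n r bound {a} {b} flow with a F.≟ b
  decompose n r bound flow | yes refl = stay flow
  decompose zero r bound flow | no a≢b with outgoing-edge a≢b flow
  ... | e , pos , _ = contradiction (ℕP.≤-trans pos (ℕP.≤-trans (≤-sum r e) bound)) λ ()
  decompose (suc n) r bound flow | no a≢b with outgoing-edge a≢b flow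
  ... | e , pos , p = prepend pos p
        (decompose n (r ─ e) (ℕP.≤-pred (ℕP.≤-trans (sum-─-< pos) bound)) (Flow-─ pos p flow))

  record EulerianWalk (y : Fin E → ℕ) (a b : Fin V) : Set where
    field
      edges : List (Fin E)
      walk : Walk a edges b
      counts : ∀ e → count edges e ≡ y e

  module _ {y : Fin E → ℕ} {ℓ f : Fin V} (connected : ∀ e → 0 < y e → Star (Edge y) ℓ (s e)) where

    module _ (D : Decomposition y ℓ f) where
      open Decomposition D

      -- Walking from a visited vertex along edges of y, the first edge with a copy left in
      -- the cycles starts at a visited vertex: every earlier edge is used up by the walk.
      spare-edge : ∀ {u w} → Star (Edge y) u w → Visit ℓ edges f u → ∀ {e₀} → 0 < cycles e₀ → s e₀ ≡ w →
                   ∃ λ e → 0 < cycles e × Visit ℓ edges f (s e)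
      spare-edge ε visit {e₀} pos₀ refl = e₀ , pos₀ , visit
      spare-edge ((e , y>0 , refl , refl) ◅ path) visit pos₀ p₀ with 0 ℕ.<? cycles e
      ... | yes pos = e , pos , visit
      ... | no ¬pos = spare-edge path (visit-target walk used) pos₀ p₀
        where
        used : 0 < count edges e
        used = subst (0 <_) (trans (sym (partition e))
                 (trans (cong (_+_ (count edges e)) (ℕP.n≤0⇒n≡0 (ℕP.≮⇒≥ ¬pos))) (ℕP.+-identityʳ _))) y>0

      FewerCycles : Set
      FewerCycles = Σ (Decomposition y ℓ f) λ D′ → sum (Decomposition.cycles D′) < sum cycles

      -- Cut the walk where it visits s e and insert e followed by a walk back to s e through the
      -- remaining cycles; what is left of them is again a circulation.
      splice : ∀ {e} → 0 < cycles e → Visit ℓ edges f (s e) → FewerCycles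
      splice {e} pos visit = D′ , smaller
        where
        open Visit visit
        C : Decomposition (cycles ─ e) (d e) (s e)
        C = decompose _ (cycles ─ e) ℕP.≤-refl (Flow-─ pos refl (circulation⇒flow {cycles} (s e) circulation))
        module C = Decomposition C
        rearrange : ∀ a b c x z → a + (x + (c + b)) + z ≡ (a + b) + ((c + z) + x)
        rearrange = solve-∀
        D′ : Decomposition y ℓ f
        D′ = record
          { edges = before ++ e ∷ (C.edges ++ after)
          ; walk = walk-before ++ʷ step refl (C.walk ++ʷ walk-after)
          ; cycles = C.cycles
          ; circulation = C.circulation
          ; partition = λ i → begin
              count (before ++ e ∷ (C.edges ++ after)) i + C.cycles i
                ≡⟨ cong (_+ C.cycles i) (trans (count-++ before _ i)
                     (cong (λ c → count before i + (δ i e + c)) (count-++ C.edges after i))) ⟩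
              count before i + (δ i e + (count C.edges i + count after i)) + C.cycles i
                ≡⟨ rearrange (count before i) (count after i) (count C.edges i) (δ i e) (C.cycles i) ⟩
              (count before i + count after i) + ((count C.edges i + C.cycles i) + δ i e)
                ≡⟨ cong₂ _+_ (sym (trans (cong (λ σ → count σ i) splits) (count-++ before after i)))
                             (trans (cong (_+ δ i e) (C.partition i)) (─-+δ pos i)) ⟩
              count edges i + cycles i
                ≡⟨ partition i ⟩
              y i ∎ }
          where open ≡-Reasoning
        smaller : sum C.cycles < sum cycles
        smaller = ℕP.≤-<-trans (sum-mono-≤ (λ i → subst (C.cycles i ≤_) (C.partition i) (ℕP.m≤n+m _ _)))
                               (sum-─-< pos)

      absorb-cycle : ∀ {e₀} → 0 < cycles e₀ → FewerCycles
      absorb-cycle {e₀} pos₀ with spare-edge (connected e₀ y>0) start pos₀ refl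
        where
        y>0 : 0 < y e₀
        y>0 = ℕP.≤-trans pos₀ (subst (cycles e₀ ≤_) (partition e₀) (ℕP.m≤n+m _ _))
        start : Visit ℓ edges f ℓ
        start = record { before = [] ; after = edges ; splits = refl ; walk-before = [] ; walk-after = walk }
      ... | e , pos , visit = splice pos visit

    finish : (D : Decomposition y ℓ f) → (∀ e → Decomposition.cycles D e ≡ 0) → EulerianWalk y ℓ f
    finish D none = record { edges = edges ; walk = walk ; counts = λ e →
      trans (sym (ℕP.+-identityʳ _)) (trans (cong (_+_ (count edges e)) (sym (none e))) (partition e)) }
      where open Decomposition D

    absorb-all : ∀ n (D : Decomposition y ℓ f) → sum (Decomposition.cycles D) ≤ n → EulerianWalk y ℓ f
    absorb-all zero D bound = finish D (λ e → ℕP.n≤0⇒n≡0 (ℕP.≤-trans (≤-sum _ e) bound))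
    absorb-all (suc n) D bound with zero-or-positive (Decomposition.cycles D)
    ... | inj₁ none = finish D none
    ... | inj₂ (_ , pos) with absorb-cycle D pos
    ...   | D′ , smaller = absorb-all n D′ (ℕP.≤-pred (ℕP.≤-trans smaller bound))

    eulerian-walk : Flow y ℓ f → EulerianWalk y ℓ f
    eulerian-walk flow = absorb-all _ (decompose _ y ℕP.≤-refl flow) ℕP.≤-refl

-- The Petri net of a leader protocol

module LeaderNet {m : ℕ} (L F : Protocol m) where
  open Net L F
  open Protocol L using () renaming (init to initᴸ; fin to finᴸ)
  open Protocol F using () renaming (n to nF; init to initᶠ; fin to finᶠ)

  Qᴸ Qᶠ : Set
  Qᴸ = Fin (Protocol.n L)
  Qᶠ = Fin nF

  ind-δ : ∀ {k} (i j : Fin k) → ind [ i == j ] ≡ δ i j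
  ind-δ i j with [ i == j ]
  ... | true = refl
  ... | false = refl

  δF : Qᶠ → Place → ℕ
  δF a (inj₁ _) = 0
  δF a (inj₂ q) = δ q a

  ind-δF : ∀ p a → ind [ p ≟P inj₂ a ] ≡ δF a p
  ind-δF (inj₁ _) a = refl
  ind-δF (inj₂ q) a = ind-δ q a

  LeadAt : Marking → Qᴸ → Set
  LeadAt M ℓ = ∀ v → M (inj₁ v) ≡ δ v ℓ

  config : Qᴸ → Qᶠ → ℕ → Marking
  config ℓ a n = toM (record { lead = ℓ ; fol = λ q → if [ q == a ] then n else 0 })

  Reach-≗ˡ : ∀ {M M′ N} → (∀ p → M p ≡ M′ p) → Reach M′ N → Reach M N
  Reach-≗ˡ M≗M′ (done M′≗N) = done (λ p → trans (M≗M′ p) (M′≗N p))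
  Reach-≗ˡ {M} M≗M′ (step {t = t} (enabled , effect) r) =
    step ((λ p → subst (Pre p t ≤_) (sym (M≗M′ p)) (enabled p)) ,
          (λ p → trans (effect p) (cong (λ k → + k +ℤ 𝒜 p t) (sym (M≗M′ p))))) r

  Reach-trans : ∀ {M M′ N} → Reach M M′ → Reach M′ N → Reach M N
  Reach-trans (done M≗M′) r = Reach-≗ˡ M≗M′ r
  Reach-trans (step fires r) r′ = step fires (Reach-trans r r′)

  Reach-≗ʳ : ∀ {M N N′} → Reach M N → (∀ p → N p ≡ N′ p) → Reach M N′
  Reach-≗ʳ r N≗N′ = Reach-trans r (done N≗N′)

  Enabled : Marking → T → Set
  Enabled M t = ∀ p → Pre p t ≤ M p

  _⟨_⟩ : Marking → T → Marking
  (M ⟨ t ⟩) p = M p ∸ Pre p t + Post p t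

  shift-fire : ∀ {M t} → Enabled M t → Shift M (λ p → Pre p t) (λ p → Post p t) (M ⟨ t ⟩)
  shift-fire {M} {t} enabled = shifting λ p → begin
    M p ∸ Pre p t + Post p t + Pre p t   ≡⟨ xy∙z≈xz∙y (M p ∸ Pre p t) (Post p t) (Pre p t) ⟩
    M p ∸ Pre p t + Pre p t + Post p t   ≡⟨ cong (_+ Post p t) (ℕP.m∸n+n≡m (enabled p)) ⟩
    M p + Post p t                       ∎
    where open ≡-Reasoning

  Post≤⟨⟩ : ∀ M t p → Post p t ≤ (M ⟨ t ⟩) p
  Post≤⟨⟩ M t p = ℕP.m≤n+m (Post p t) (M p ∸ Pre p t)

  Fires⇒Shift : ∀ {M t N} → Fires M t N → Shift M (λ p → Pre p t) (λ p → Post p t) N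
  Fires⇒Shift (_ , effect) = shifting λ p → ℤ⇒shift (effect p)

  fire : ∀ {M t} → Enabled M t → Fires M t (M ⟨ t ⟩)
  fire enabled = enabled , λ p → shift⇒ℤ (Shift.balance (shift-fire enabled) p)

  valid : ∀ t → validPair (rules t) ≡ true
  valid t = lookup-filterᵇ validPair (List.cartesianProduct allGRules allGRules) t

  fromOf toOf : GRule × GRule → Maybe Qᴸ
  fromOf rr = orElse (leaderSrc (proj₁ rr)) (leaderSrc (proj₂ rr))
  toOf rr = orElse (leaderTgt (proj₁ rr)) (leaderTgt (proj₂ rr))

  PreOf PostOf : Place → GRule × GRule → ℕ
  PreOf p rr = ind [ p ≟P src (proj₁ rr) ] + ind [ p ≟P src (proj₂ rr) ]
  PostOf p rr = ind [ p ≟P tgt (proj₁ rr) ] + ind [ p ≟P tgt (proj₂ rr) ]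

  -- Junk value initᴸ for follower transitions, whose `from`/`to` are nothing.
  sourceOf targetOf : GRule × GRule → Qᴸ
  sourceOf rr = fromMaybe initᴸ (fromOf rr)
  targetOf rr = fromMaybe initᴸ (toOf rr)

  source target : T → Qᴸ
  source t = sourceOf (rules t)
  target t = targetOf (rules t)

  -- Stated for the pair of rules (r , r′) of t_{r,r′}, so that it can be proved by cases on rules t.
  record LeaderShape (rr : GRule × GRule) : Set where
    field
      from-source : fromOf rr ≡ just (sourceOf rr)
      to-target : toOf rr ≡ just (targetOf rr)
      Pre-leader : ∀ v → PreOf (inj₁ v) rr ≡ δ v (sourceOf rr)
      Post-leader : ∀ v → PostOf (inj₁ v) rr ≡ δ v (targetOf rr)

  leader-shape : ∀ t → isLeaderT t ≡ true → LeaderShape (rules t)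
  leader-shape t isL with rules t
  ... | inj₁ (q , _ , q′) , inj₂ _ = record
    { from-source = refl ; to-target = refl
    ; Pre-leader = λ v → trans (ℕP.+-identityʳ _) (ind-δ v q)
    ; Post-leader = λ v → trans (ℕP.+-identityʳ _) (ind-δ v q′) }
  ... | inj₂ _ , inj₁ (q , _ , q′) = record
    { from-source = refl ; to-target = refl
    ; Pre-leader = λ v → ind-δ v q
    ; Post-leader = λ v → ind-δ v q′ }
  leader-shape t () | inj₁ _ , inj₁ _
  leader-shape t () | inj₂ _ , inj₂ _

  -- A transition t_{r,r′} with both rules in R^L is never built.
  follower-shape : ∀ t → isLeaderT t ≡ false → (∀ v → Pre (inj₁ v) t ≡ 0) × (∀ v → Post (inj₁ v) t ≡ 0)
  follower-shape t isF with rules t | valid t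
  ... | inj₂ _ , inj₂ _ | _ = (λ _ → refl) , (λ _ → refl)
  ... | inj₁ (q , α , q′) , inj₁ (p , β , p′) | ok =
    contradiction (trans (sym ok) (∧-false (Protocol.R L q α q′) (Protocol.R L p β p′) _)) λ ()
    where
    ∧-false : ∀ a b c → a ∧ (b ∧ (c ∧ false)) ≡ false
    ∧-false a b c rewrite BoolP.∧-zeroʳ c | BoolP.∧-zeroʳ b = BoolP.∧-zeroʳ a
  follower-shape t () | inj₁ _ , inj₂ _ | _
  follower-shape t () | inj₂ _ , inj₁ _ | _

  lead-step : ∀ {M N t ℓ} → isLeaderT t ≡ true → source t ≡ ℓ → LeadAt M ℓ →
              Shift M (λ p → Pre p t) (λ p → Post p t) N → LeadAt N (target t)
  lead-step {M} {N} {t} isL refl atℓ (shifting balance) v = ℕP.+-cancelʳ-≡ (δ v (source t)) _ _ (begin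
    N (inj₁ v) + δ v (source t)       ≡⟨ cong (_+_ (N (inj₁ v))) (Pre-leader v) ⟨
    N (inj₁ v) + Pre (inj₁ v) t       ≡⟨ balance (inj₁ v) ⟩
    M (inj₁ v) + Post (inj₁ v) t      ≡⟨ cong₂ _+_ (atℓ v) (Post-leader v) ⟩
    δ v (source t) + δ v (target t)   ≡⟨ ℕP.+-comm (δ v (source t)) _ ⟩
    δ v (target t) + δ v (source t)   ∎)
    where
    open LeaderShape (leader-shape t isL)
    open ≡-Reasoning

  follow-step : ∀ {M N t ℓ} → isLeaderT t ≡ false → LeadAt M ℓ →
                Shift M (λ p → Pre p t) (λ p → Post p t) N → LeadAt N ℓ
  follow-step {M} {N} {t} {ℓ} isF atℓ (shifting balance) v = begin
    N (inj₁ v)                      ≡⟨ ℕP.+-identityʳ _ ⟨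
    N (inj₁ v) + 0                  ≡⟨ cong (_+_ (N (inj₁ v))) (proj₁ (follower-shape t isF) v) ⟨
    N (inj₁ v) + Pre (inj₁ v) t     ≡⟨ balance (inj₁ v) ⟩
    M (inj₁ v) + Post (inj₁ v) t    ≡⟨ cong₂ _+_ (atℓ v) (proj₂ (follower-shape t isF) v) ⟩
    δ v ℓ + 0                       ≡⟨ ℕP.+-identityʳ _ ⟩
    δ v ℓ                           ∎
    where open ≡-Reasoning

  lead-enabled : ∀ {M t ℓ} → isLeaderT t ≡ true → source t ≡ ℓ → LeadAt M ℓ → ∀ v → Pre (inj₁ v) t ≤ M (inj₁ v)
  lead-enabled {t = t} isL refl atℓ v =
    ℕP.≤-reflexive (trans (LeaderShape.Pre-leader (leader-shape t isL) v) (sym (atℓ v)))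

  follow-enabled : ∀ {M : Marking} {t} → isLeaderT t ≡ false → ∀ v → Pre (inj₁ v) t ≤ M (inj₁ v)
  follow-enabled {M} {t} isF v = subst (_≤ M (inj₁ v)) (sym (proj₁ (follower-shape t isF) v)) z≤n

  enabled-source : ∀ {M t ℓ} → isLeaderT t ≡ true → Enabled M t → LeadAt M ℓ → source t ≡ ℓ
  enabled-source {M} {t} {ℓ} isL enabled atℓ = δ-positive (begin
    1                            ≡⟨ δ-refl (source t) ⟨
    δ (source t) (source t)      ≡⟨ Pre-leader (source t) ⟨
    Pre (inj₁ (source t)) t      ≤⟨ enabled (inj₁ (source t)) ⟩
    M (inj₁ (source t))          ≡⟨ atℓ (source t) ⟩
    δ (source t) ℓ               ∎)
    where
    open LeaderShape (leader-shape t isL)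
    open ℕP.≤-Reasoning

  data LeaderWalk : Qᴸ → List T → Qᴸ → Set where
    [] : ∀ {ℓ} → LeaderWalk ℓ [] ℓ
    lead : ∀ {ℓ t τ ℓ′} → isLeaderT t ≡ true → source t ≡ ℓ → LeaderWalk (target t) τ ℓ′ →
           LeaderWalk ℓ (t ∷ τ) ℓ′
    follow : ∀ {ℓ t τ ℓ′} → isLeaderT t ≡ false → LeaderWalk ℓ τ ℓ′ → LeaderWalk ℓ (t ∷ τ) ℓ′

  Pre* Post* : List T → Place → ℕ
  Pre* τ p = sumList (List.map (λ t → Pre p t) τ)
  Post* τ p = sumList (List.map (λ t → Post p t) τ)

  Pre*≤ : ∀ τ p → Pre* τ p ≤ List.length τ * 2
  Pre*≤ [] p = z≤n
  Pre*≤ (t ∷ τ) p = ℕP.+-mono-≤ (ℕP.+-mono-≤ (ind≤1 [ p ≟P src (proj₁ (rules t)) ])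
                                              (ind≤1 [ p ≟P src (proj₂ (rules t)) ]))
                                (Pre*≤ τ p)
    where
    ind≤1 : ∀ b → ind b ≤ 1
    ind≤1 true = ℕP.≤-refl
    ind≤1 false = z≤n

  record Trace (M N : Marking) (ℓ : Qᴸ) : Set where
    field
      transitions : List T
      last : Qᴸ
      shift : Shift M (Pre* transitions) (Post* transitions) N
      route : LeaderWalk ℓ transitions last

  trace-step : ∀ {M M′ N t ℓ ℓ₁} → Shift M (λ p → Pre p t) (λ p → Post p t) M′ →
               (∀ {τ ℓ′} → LeaderWalk ℓ₁ τ ℓ′ → LeaderWalk ℓ (t ∷ τ) ℓ′) → Trace M′ N ℓ₁ → Trace M N ℓ
  trace-step {t = t} shift₁ extend T′ = record
    { transitions = t ∷ transitions ; last = last ; shift = Shift-trans shift₁ shift ; route = extend route }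
    where open Trace T′

  trace : ∀ {M N ℓ} → Reach M N → LeadAt M ℓ → Trace M N ℓ
  trace (done M≗N) atℓ =
    record { transitions = [] ; shift = shifting (λ p → cong (_+ 0) (sym (M≗N p))) ; route = [] }
  trace (step {t = t} fires reach) atℓ with isLeaderT t in isL
  ... | true = trace-step shift (lead isL source≡) (trace reach (lead-step isL source≡ atℓ shift))
    where
    shift = Fires⇒Shift fires
    source≡ = enabled-source isL (proj₁ fires) atℓ
  ... | false = trace-step shift (follow isL) (trace reach (follow-step isL atℓ shift))
    where shift = Fires⇒Shift fires

  record Run (M : Marking) (τ : List T) (ℓ′ : Qᴸ) : Set where
    field
      final : Marking
      shift : Shift M (Pre* τ) (Post* τ) final
      leader : LeadAt final ℓ′
      reach : Reach M final

  enabled-by : ∀ {M t τ} → (∀ v → Pre (inj₁ v) t ≤ M (inj₁ v)) → (∀ q → Pre* (t ∷ τ) (inj₂ q) ≤ M (inj₂ q)) →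
               Enabled M t
  enabled-by leader-enabled _ (inj₁ v) = leader-enabled v
  enabled-by _ enough (inj₂ q) = ℕP.m+n≤o⇒m≤o _ (enough q)

  execute : ∀ {M ℓ τ ℓ′} → LeaderWalk ℓ τ ℓ′ → LeadAt M ℓ → (∀ q → Pre* τ (inj₂ q) ≤ M (inj₂ q)) → Run M τ ℓ′
  execute-after : ∀ {M t τ ℓ₁ ℓ′} → (∀ v → Pre (inj₁ v) t ≤ M (inj₁ v)) →
                  (∀ {N} → Shift M (λ p → Pre p t) (λ p → Post p t) N → LeadAt N ℓ₁) → LeaderWalk ℓ₁ τ ℓ′ →
                  (∀ q → Pre* (t ∷ τ) (inj₂ q) ≤ M (inj₂ q)) → Run M (t ∷ τ) ℓ′

  execute {M} [] atℓ _ =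
    record { final = M ; shift = shifting (λ _ → refl) ; leader = atℓ ; reach = done (λ _ → refl) }
  execute {M} (lead isL src walk) atℓ enough =
    execute-after (lead-enabled {M} isL src atℓ) (lead-step isL src atℓ) walk enough
  execute {M} (follow isF walk) atℓ enough =
    execute-after (follow-enabled {M} isF) (follow-step isF atℓ) walk enough

  execute-after {M} {t} {τ} leader-enabled moves walk enough = record
    { final = final ; shift = Shift-trans shift₁ shift ; leader = leader ; reach = step (fire enabled) reach }
    where
    enabled = enabled-by {τ = τ} leader-enabled enough
    shift₁ = shift-fire enabled
    open Run (execute {M ⟨ t ⟩} walk (moves shift₁)
                      (λ q → Shift-bound shift₁ (inj₂ q) (Pre* τ (inj₂ q)) (enough q)))

  GReach-mono : ∀ {x x′ : T → ℕ} → (∀ t → x t ≤ x′ t) → ∀ {u v} → GReach x u v → GReach x′ u v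
  GReach-mono x≤x′ = gmap id λ (t , isL , pos , from≡ , to≡) → t , isL , ℕP.≤-trans pos (x≤x′ t) , from≡ , to≡

  route-connects : ∀ {ℓ τ ℓ′} → LeaderWalk ℓ τ ℓ′ → ∀ v → GVertex (count τ) v → GReach (count τ) ℓ v
  route-connects [] v (_ , _ , () , _)
  route-connects (lead {t = t} {τ} isL refl route) v (t′ , isL′ , pos , ends) = by-cases (t′ F.≟ t)
    where
    open LeaderShape (leader-shape t isL)
    edge : GEdge (count (t ∷ τ)) (source t) (target t)
    edge = t , isL , count-head t τ , from-source , to-target
    by-cases : Dec (t′ ≡ t) → GReach (count (t ∷ τ)) (source t) v
    by-cases (yes t′≡t) with subst (λ s → from s ≡ just v ⊎ to s ≡ just v) t′≡t ends
    ... | inj₁ from≡ = subst (GReach _ (source t)) (MaybeP.just-injective (trans (sym from-source) from≡)) ε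
    ... | inj₂ to≡ = subst (GReach _ (source t)) (MaybeP.just-injective (trans (sym to-target) to≡)) (edge ◅ ε)
    by-cases (no t′≢t) = edge ◅ GReach-mono (count-tail t τ)
      (route-connects route v (t′ , isL′ , subst (λ c → 0 < c + count τ t′) (δ-≢ t′≢t) pos , ends))
  route-connects (follow {t = t} {τ} isF route) v (t′ , isL′ , pos , ends) = by-cases (t′ F.≟ t)
    where
    by-cases : Dec (t′ ≡ t) → GReach (count (t ∷ τ)) _ v
    by-cases (yes t′≡t) = contradiction (trans (sym isL′) (trans (cong isLeaderT t′≡t) isF)) λ ()
    by-cases (no t′≢t) = GReach-mono (count-tail t τ)
      (route-connects route v (t′ , isL′ , subst (λ c → 0 < c + count τ t′) (δ-≢ t′≢t) pos , ends))

  consumed produced : (T → ℕ) → Place → ℕ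
  consumed x p = sum (λ t → x t * Pre p t)
  produced x p = sum (λ t → x t * Post p t)

  𝒜·-split : ∀ x p → 𝒜· x p ≡ + produced x p - + consumed x p
  𝒜·-split x p = trans (foldr-differences (λ t → 𝒜 p t ℤ.* + x t) produced₁ consumed₁ entry (List.allFin _))
                       (cong₂ (λ a b → + a - + b) (sum-allFin produced₁) (sum-allFin consumed₁))
    where
    produced₁ consumed₁ : T → ℕ
    produced₁ t = x t * Post p t
    consumed₁ t = x t * Pre p t
    distrib : ∀ a b c → (a - b) ℤ.* c ≡ c ℤ.* a - c ℤ.* b
    distrib = ℤSolver.solve-∀
    entry : ∀ t → 𝒜 p t ℤ.* + x t ≡ + produced₁ t - + consumed₁ t
    entry t = trans (distrib (+ Post p t) (+ Pre p t) (+ x t))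
                    (sym (cong₂ _-_ (ℤP.pos-* (x t) (Post p t)) (ℤP.pos-* (x t) (Pre p t))))

  marking-equation : ∀ {M N τ} → Shift M (Pre* τ) (Post* τ) N → ∀ p → + N p ≡ + M p +ℤ 𝒜· (count τ) p
  marking-equation {M} {N} {τ} (shifting balance) p =
    trans (shift⇒ℤ {N p} {M p} (balance p)) (cong (_+ℤ_ (+ M p)) (sym (begin
      𝒜· (count τ) p                                    ≡⟨ 𝒜·-split (count τ) p ⟩
      + produced (count τ) p - + consumed (count τ) p   ≡⟨ cong₂ (λ a b → + a - + b) (sum-count (λ t → Post p t) τ)
                                                                                   (sum-count (λ t → Pre p t) τ) ⟩
      + Post* τ p - + Pre* τ p                          ∎)))
    where open ≡-Reasoning

  run⇒solution : ∀ {k} → Reach (toM (Cinit k)) (toM (Cfin k)) →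
    Σ (T → ℕ) λ x → Compatible (Cinit k) x × (∀ p → + toM (Cfin k) p ≡ + toM (Cinit k) p +ℤ 𝒜· x p)
  run⇒solution reach = count transitions , (nonnegative , route-connects route) , equation
    where
    open Trace (trace reach (λ v → ind-δ v initᴸ))
    equation = marking-equation {τ = transitions} shift
    nonnegative : ∀ p → + 0 ℤ.≤ + toM (Cinit _) p +ℤ 𝒜· (count transitions) p
    nonnegative p = subst (+ 0 ℤ.≤_) (equation p) (+≤+ z≤n)

  leaderPart followerPart : (T → ℕ) → T → ℕ
  leaderPart x t = if isLeaderT t then x t else 0
  followerPart x t = if isLeaderT t then 0 else x t

  leaderPart+followerPart : ∀ x t → leaderPart x t + followerPart x t ≡ x t
  leaderPart+followerPart x t with isLeaderT t
  ... | true = ℕP.+-identityʳ (x t)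
  ... | false = refl

  leaderPart-leader : ∀ x {t} → isLeaderT t ≡ true → leaderPart x t ≡ x t
  leaderPart-leader x isL rewrite isL = refl

  leaderPart-positive : ∀ x t → 0 < leaderPart x t → isLeaderT t ≡ true × 0 < x t
  leaderPart-positive x t pos with isLeaderT t
  ... | true = refl , pos

  followerPart-positive : ∀ x t → 0 < followerPart x t → isLeaderT t ≡ false
  followerPart-positive x t pos with isLeaderT t
  ... | false = refl

  open Eulerian source target using (outdeg; indeg; Flow; Edge; Walk; []; step; EulerianWalk; eulerian-walk)

  leader-column : ∀ x v (W : Place → T → ℕ) (end : T → Qᴸ) →
                  (∀ t → isLeaderT t ≡ true → W (inj₁ v) t ≡ δ v (end t)) →
                  (∀ t → isLeaderT t ≡ false → W (inj₁ v) t ≡ 0) →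
                  sum (λ t → x t * W (inj₁ v) t) ≡ sum (λ t → leaderPart x t * δ v (end t))
  leader-column x v W end on-leader on-follower = sum-cong-≗ entry
    where
    entry : ∀ t → x t * W (inj₁ v) t ≡ leaderPart x t * δ v (end t)
    entry t with isLeaderT t in isL
    ... | true = cong (x t *_) (on-leader t isL)
    ... | false = trans (cong (x t *_) (on-follower t isL)) (ℕP.*-zeroʳ (x t))

  -- The leader's column of the marking equation is Euler's balance condition on the leader graph.
  leader-flow : ∀ {x ℓ ℓ′ a a′ n n′} →
    Shift (config ℓ a n) (consumed x) (produced x) (config ℓ′ a′ n′) → Flow (leaderPart x) ℓ ℓ′
  leader-flow {x} {ℓ} {ℓ′} (shifting balance) v = begin
    δ v ℓ′ + outdeg (leaderPart x) v        ≡⟨ cong₂ _+_ (ind-δ v ℓ′) consumed-leader ⟨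
    ind [ v == ℓ′ ] + consumed x (inj₁ v)   ≡⟨ balance (inj₁ v) ⟩
    ind [ v == ℓ ] + produced x (inj₁ v)    ≡⟨ cong₂ _+_ (ind-δ v ℓ) produced-leader ⟩
    δ v ℓ + indeg (leaderPart x) v          ∎
    where
    open ≡-Reasoning
    consumed-leader = leader-column x v Pre source (λ t isL → LeaderShape.Pre-leader (leader-shape t isL) v)
                                                   (λ t isF → proj₁ (follower-shape t isF) v)
    produced-leader = leader-column x v Post target (λ t isL → LeaderShape.Post-leader (leader-shape t isL) v)
                                                    (λ t isF → proj₂ (follower-shape t isF) v)

  support-connected : ∀ {x ℓ} → (∀ v → GVertex x v → GReach x ℓ v) →
                      ∀ e → 0 < leaderPart x e → Star (Edge (leaderPart x)) ℓ (source e)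
  support-connected {x} connected e pos with leaderPart-positive x e pos
  ... | isL , x>0 = gmap id support-edge (connected (source e) (e , isL , x>0 , inj₁ from-source))
    where
    open LeaderShape (leader-shape e isL) using (from-source)
    support-edge : ∀ {u w} → GEdge x u w → Edge (leaderPart x) u w
    support-edge (t , isL , pos , from≡ , to≡) =
      t , subst (0 <_) (sym (leaderPart-leader x isL)) pos , cong (fromMaybe initᴸ) from≡ , cong (fromMaybe initᴸ) to≡

  walk-route : ∀ {a σ b ρ c} → Walk a σ b → All (λ e → isLeaderT e ≡ true) σ → LeaderWalk b ρ c →
               LeaderWalk a (σ ++ ρ) c
  walk-route [] [] route = route
  walk-route (step refl walk) (isL ∷ leaders) route = lead isL refl (walk-route walk leaders route)

  idle-route : ∀ {ℓ ρ} → All (λ e → isLeaderT e ≡ false) ρ → LeaderWalk ℓ ρ ℓ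
  idle-route [] = []
  idle-route (isF ∷ followers) = follow isF (idle-route followers)

  ==-refl : ∀ {k} (i : Fin k) → [ i == i ] ≡ true
  ==-refl i with i F.≟ i
  ... | yes _ = refl
  ... | no i≢i = contradiction refl i≢i

  act-∈ : ∀ α → α ∈ allActs m
  act-∈ (snd x) = ∈-++⁺ˡ (∈-map⁺ snd (∈-allFin x))
  act-∈ (rcv x) = ∈-++⁺ʳ (List.map snd (List.allFin m)) (∈-map⁺ rcv (∈-allFin x))

  follower-rule-∈ : ∀ q α q′ → _∈_ {A = GRule} (inj₂ (q , α , q′)) allGRules
  follower-rule-∈ q α q′ = ∈-++⁺ʳ (List.map inj₁ (triples m (Protocol.n L)))
    (∈-map⁺ inj₂ (∈-cartesianProduct⁺ (∈-allFin q) (∈-cartesianProduct⁺ (act-∈ α) (∈-allFin q′))))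

  transition-of : ∀ rr → rr ∈ List.cartesianProduct allGRules allGRules → validPair rr ≡ true →
                  Σ T λ t → rules t ≡ rr
  transition-of rr rr∈ ok = Any.index rr∈Ts , sym (lookup-index rr∈Ts)
    where rr∈Ts = ∈-filter⁺ (T? ∘ validPair) rr∈ (Equivalence.from BoolP.T-≡ ok)

  -- Moves two followers from a to c; for instance t_{r,r′} with r = (a , !x , c) and r′ = (a , ?x , c).
  PairMove : Qᶠ → Qᶠ → Set
  PairMove a c = Σ T λ t → (∀ p → Pre p t ≡ 2 * δF a p) × (∀ p → Post p t ≡ 2 * δF c p)

  pair-move : ∀ {a c} x → Protocol.R F a (snd x) c ≡ true → Protocol.R F a (rcv x) c ≡ true → PairMove a c
  pair-move {a} {c} x sends receives
    with transition-of (inj₂ (a , snd x , c) , inj₂ (a , rcv x , c))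
           (∈-cartesianProduct⁺ (follower-rule-∈ a (snd x) c) (follower-rule-∈ a (rcv x) c)) ok
    where
    ok : validPair (inj₂ (a , snd x , c) , inj₂ (a , rcv x , c)) ≡ true
    ok rewrite sends | receives | ==-refl x = refl
  ... | t , rules≡ = t , (λ p → trans (cong (PreOf p) rules≡) (doubled (ind-δF p a)))
                       , (λ p → trans (cong (PostOf p) rules≡) (doubled (ind-δF p c)))
    where
    doubled : ∀ {x y} → x ≡ y → x + x ≡ 2 * y
    doubled {y = y} refl = cong (_+_ y) (sym (ℕP.+-identityʳ y))

  padding : ℕ → Place → ℕ
  padding w (inj₁ _) = 0
  padding w (inj₂ _) = w

  padded : Marking → ℕ → Marking
  padded M w p = M p + padding w p

  sum-pairs-everywhere : ∀ k (q : Qᶠ) → sum (λ i → k * (2 * δ q i)) ≡ k * 2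
  sum-pairs-everywhere k q = trans (sum-cong-≗ (λ i → sym (ℕP.*-assoc k 2 (δ q i)))) (sum-δ′ q (const (k * 2)))

  -- k pairs moved from a to each of the nF follower states.
  spread-shift : ∀ ℓ a n k → Shift (config ℓ a (n + nF * k * 2))
                                   (λ p → sum {nF} (λ _ → k * (2 * δF a p)))
                                   (λ p → sum (λ i → k * (2 * δF i p)))
                                   (padded (config ℓ a n) (k * 2))
  spread-shift ℓ a n k = shifting balance
    where
    no-leader-pairs : sum {nF} (λ _ → k * 0) ≡ 0
    no-leader-pairs = sum-zero {nF} (λ _ → ℕP.*-zeroʳ k)
    identity : ∀ n d k c → n * d + k * 2 + c * (k * (2 * d)) ≡ (n + c * k * 2) * d + k * 2
    identity = solve-∀
    balance : ∀ p → padded (config ℓ a n) (k * 2) p + sum {nF} (λ _ → k * (2 * δF a p))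
                  ≡ config ℓ a (n + nF * k * 2) p + sum (λ i → k * (2 * δF i p))
    balance (inj₁ v) = trans (cong₂ _+_ (ℕP.+-identityʳ _) no-leader-pairs) (cong (_+_ _) (sym no-leader-pairs))
    balance (inj₂ q) = begin
      (if [ q == a ] then n else 0) + k * 2 + sum {nF} (λ _ → k * (2 * δ q a))
        ≡⟨ cong₂ _+_ (cong (_+ k * 2) (if-as-δ n q a)) (sum-const nF _) ⟩
      n * δ q a + k * 2 + nF * (k * (2 * δ q a))
        ≡⟨ identity n (δ q a) k nF ⟩
      (n + nF * k * 2) * δ q a + k * 2
        ≡⟨ cong₂ _+_ (if-as-δ (n + nF * k * 2) q a) (sum-pairs-everywhere k q) ⟨
      (if [ q == a ] then n + nF * k * 2 else 0) + sum (λ i → k * (2 * δ q i)) ∎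
      where open ≡-Reasoning

  module FollowerPairs (symF : Symmetric F) where

    pair-transition : ∀ {a c} → FEdge F a c → PairMove a c
    pair-transition {a} {c} (snd x , rule) = pair-move x rule (trans (sym (symF a x c)) rule)
    pair-transition {a} {c} (rcv x , rule) = pair-move x (trans (symF a x c) rule) rule

    pair-enabled : ∀ {M : Marking} a → 2 ≤ M (inj₂ a) → ∀ p → 2 * δF a p ≤ M p
    pair-enabled a two (inj₁ _) = z≤n
    pair-enabled a two (inj₂ q) with q F.≟ a
    ... | yes refl = two
    ... | no _ = z≤n

    move-pair : ∀ {a b} → FReach F a b → ∀ {M} → 2 ≤ M (inj₂ a) →
                Σ Marking λ N → Shift M (λ p → 2 * δF a p) (λ p → 2 * δF b p) N × Reach M N
    move-pair ε {M} _ = M , shifting (λ _ → refl) , done (λ _ → refl)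
    move-pair {a} (_◅_ {j = c} edge path) {M} two with pair-transition edge
    ... | t , pre , post with move-pair path two′
      where
      two′ : 2 ≤ (M ⟨ t ⟩) (inj₂ c)
      two′ = subst (_≤ (M ⟨ t ⟩) (inj₂ c)) (trans (post (inj₂ c)) (cong (2 *_) (δ-refl c)))
                   (Post≤⟨⟩ M t (inj₂ c))
    ... | N , shift , reach = N , Shift-chain (Shift-cong (shift-fire enabled) pre post) shift
                                , step (fire enabled) reach
      where
      enabled : Enabled M t
      enabled p = subst (_≤ M p) (sym (pre p)) (pair-enabled {M} a two p)

    move-pairs : ∀ {a b} → FReach F a b → ∀ k {M} → k * 2 ≤ M (inj₂ a) →
                 Σ Marking λ N → Shift M (λ p → k * (2 * δF a p)) (λ p → k * (2 * δF b p)) N × Reach M N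
    move-pairs path zero {M} _ = M , shifting (λ _ → refl) , done (λ _ → refl)
    move-pairs {a} path (suc k) {M} bound with move-pair path (ℕP.m+n≤o⇒m≤o 2 bound)
    ... | M₁ , shift₁ , reach₁ with move-pairs path k (Shift-bound shift₁ (inj₂ a) (k * 2) bound′)
      where
      bound′ : 2 * δ a a + k * 2 ≤ M (inj₂ a)
      bound′ = subst (λ x → 2 * x + k * 2 ≤ M (inj₂ a)) (sym (δ-refl a)) bound
    ... | N , shift₂ , reach₂ = N , Shift-trans shift₁ shift₂ , Reach-trans reach₁ reach₂

    move-pair-family : ∀ {K} (g h : Fin K → Qᶠ) → (∀ i → FReach F (g i) (h i)) → ∀ k {M} →
                       (∀ q → sum (λ i → k * (2 * δ q (g i))) ≤ M (inj₂ q)) →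
                       Σ Marking λ N → Shift M (λ p → sum (λ i → k * (2 * δF (g i) p)))
                                               (λ p → sum (λ i → k * (2 * δF (h i) p))) N × Reach M N
    move-pair-family {zero} g h paths k {M} _ = M , shifting (λ _ → refl) , done (λ _ → refl)
    move-pair-family {suc K} g h paths k {M} bound with move-pairs (paths zero) k first
      where
      first : k * 2 ≤ M (inj₂ (g zero))
      first = subst (λ x → k * (2 * x) ≤ M (inj₂ (g zero))) (δ-refl (g zero))
                    (ℕP.m+n≤o⇒m≤o _ (bound (g zero)))
    ... | M₁ , shift₁ , reach₁
            with move-pair-family (g ∘ suc) (h ∘ suc) (paths ∘ suc) k
                                  (λ q → Shift-bound shift₁ (inj₂ q) _ (bound q))
    ... | N , shift₂ , reach₂ = N , Shift-trans shift₁ shift₂ , Reach-trans reach₁ reach₂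

  module Pumping (symF : Symmetric F) (reachF : ∀ q → FReach F initᶠ q × FReach F q finᶠ) where
    open FollowerPairs symF

    spread : ∀ n k → Reach (config initᴸ initᶠ (n + nF * k * 2))
                           (padded (config initᴸ initᶠ n) (k * 2))
    spread n k with move-pair-family (const initᶠ) id (proj₁ ∘ reachF) k enough
      where
      a = initᶠ
      identity : ∀ n d k c → n * d + c * (k * (2 * d)) ≡ (n + c * k * 2) * d
      identity = solve-∀
      enough : ∀ q → sum {nF} (λ _ → k * (2 * δ q a)) ≤ config initᴸ a (n + nF * k * 2) (inj₂ q)
      enough q = begin
        sum {nF} (λ _ → k * (2 * δ q a))         ≡⟨ sum-const nF _ ⟩
        nF * (k * (2 * δ q a))                   ≤⟨ ℕP.m≤n+m _ (n * δ q a) ⟩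
        n * δ q a + nF * (k * (2 * δ q a))       ≡⟨ identity n (δ q a) k nF ⟩
        (n + nF * k * 2) * δ q a                 ≡⟨ if-as-δ (n + nF * k * 2) q a ⟨
        (if [ q == a ] then n + nF * k * 2 else 0) ∎
        where open ℕP.≤-Reasoning
    ... | N , shift , reach = Reach-≗ʳ reach (Shift-functional shift (spread-shift _ _ n k))

    collect : ∀ n k → Reach (padded (config finᴸ finᶠ n) (k * 2))
                            (config finᴸ finᶠ (n + nF * k * 2))
    collect n k with move-pair-family id (const finᶠ) (proj₂ ∘ reachF) k enough
      where
      M = padded (config finᴸ finᶠ n) (k * 2)
      enough : ∀ q → sum (λ i → k * (2 * δ q i)) ≤ M (inj₂ q)
      enough q = subst (_≤ M (inj₂ q)) (sym (sum-pairs-everywhere k q)) (ℕP.m≤n+m (k * 2) _)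
    ... | N , shift , reach = Reach-≗ʳ reach (Shift-functional shift (Shift-sym (spread-shift _ _ n k)))

    solution⇒pumped-run : ∀ {n x} → Compatible (Cinit n) x →
                          (∀ p → + toM (Cfin n) p ≡ + toM (Cinit n) p +ℤ 𝒜· x p) →
                          Σ ℕ λ k → Reach (toM (Cinit (n + nF * k * 2))) (toM (Cfin (n + nF * k * 2)))
    solution⇒pumped-run {n} {x} (_ , connected) equation =
      k , Reach-trans (spread n k)
            (Reach-trans (Reach-≗ʳ reach (Shift-functional shift balanced)) (collect n k))
      where
      balance : Shift (toM (Cinit n)) (consumed x) (produced x) (toM (Cfin n))
      balance = shifting λ p → ℤ⇒shift (trans (equation p) (cong (_+ℤ_ (+ toM (Cinit n) p)) (𝒜·-split x p)))
      open EulerianWalk (eulerian-walk (support-connected connected) (leader-flow balance))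
      τ = edges ++ fromCounts (followerPart x)
      τ-route : LeaderWalk initᴸ τ finᴸ
      τ-route = walk-route walk leaders (idle-route followers)
        where
        leaders = count⇒All edges λ e pos → proj₁ (leaderPart-positive x e (subst (0 <_) (counts e) pos))
        followers = count⇒All _ λ e pos → followerPart-positive x e (subst (0 <_) (count-fromCounts _ e) pos)
      τ-count : ∀ t → count τ t ≡ x t
      τ-count t = trans (count-++ edges _ t)
                        (trans (cong₂ _+_ (counts t) (count-fromCounts _ t)) (leaderPart+followerPart x t))
      -- No transition takes more than two followers from a state, so k * 2 spare ones always suffice.
      k = List.length τ
      open Run (execute {padded (toM (Cinit n)) (k * 2)} τ-route (λ v → trans (ℕP.+-identityʳ _) (ind-δ v _))
                        (λ q → ℕP.≤-trans (Pre*≤ τ (inj₂ q)) (ℕP.m≤n+m (k * 2) _)))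
      by-count : ∀ (W : T → Place → ℕ) p → sum (λ t → x t * W t p) ≡ sumList (List.map (λ t → W t p) τ)
      by-count W p = trans (sum-cong-≗ (λ t → cong (_* W t p) (sym (τ-count t)))) (sum-count (λ t → W t p) τ)
      balanced : Shift (padded (toM (Cinit n)) (k * 2)) (Pre* τ) (Post* τ) (padded (toM (Cfin n)) (k * 2))
      balanced = Shift-+ (padding (k * 2))
                         (Shift-cong balance (by-count (λ t p → Pre p t)) (by-count (λ t p → Post p t)))

-- The leader never fires a rule together with another leader.
lemma7p9 : ∀ {m} (L F : Protocol m) → Symmetric L → Symmetric F
    → (∀ q → FReach F (Protocol.init F) q × FReach F q (Protocol.fin F))
    → (par : ℕ) → par < 2
    → (Σ ℕ λ k → k % 2 ≡ par × Net.Reach L F (Net.toM L F (Net.Cinit L F k)) (Net.toM L F (Net.Cfin L F k)))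
      ⇔ (Σ ℕ λ n → Σ (Net.T L F → ℕ) λ x → n % 2 ≡ par
           × Net.Compatible L F (Net.Cinit L F n) x
           × (∀ p → + Net.toM L F (Net.Cfin L F n) p ≡ + Net.toM L F (Net.Cinit L F n) p +ℤ Net.𝒜· L F x p))
lemma7p9 L F _ symF reachF par _ = mk⇔
  (λ (k , k%2 , reach) →
     let (x , compatible , equation) = run⇒solution reach in
     k , x , k%2 , compatible , equation)
  (λ (n , x , n%2 , compatible , equation) →
     let (k , reach) = solution⇒pumped-run compatible equation in
     n + Protocol.n F * k * 2 , trans ([m+kn]%n≡m%n n (Protocol.n F * k) 2) n%2 , reach)
  where
  open LeaderNet L F
  open Pumping symF reachF
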